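{- Let $\Gamma$ be a finite nonabelian group with $|Z(\Gamma)|\geq 2$, and let $\mathscr{C}$ be the collection of all maximal abelian subgroups of $\Gamma$. If $|\mathscr{C}|\leq 2^{|Z(\Gamma)|}$, then $rc(CG(\Gamma))=2$.
   Context: For a finite group $\Gamma$, the commuting graph $CG(\Gamma)$ is the simple graph with vertex set $\Gamma$ in which two distinct elements $a,b$ are adjacent if and only if $ab=ba$. For a connected graph $G$, an edge coloring (adjacent edges may share colors) makes $G$ rainbow-connected if every two distinct vertices are joined by a path whose edges all have pairwise distinct colors; the rainbow connection number $rc(G)$ is the minimum number of colors in such a coloring. $Z(\Gamma)=\{z\in\Gamma: za=az \text{ for all } a\in\Gamma\}$ is the center of $\Gamma$. A maximal abelian subgroup of $\Gamma$ is an abelian subgroup not properly contained in any other abelian subgroup of $\Gamma$. -}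

module Defs where

open import Level using (0ℓ)
open import Data.Nat using (ℕ; _<_)
open import Data.Fin using (Fin)
open import Data.Fin.Subset using (Subset; _∈_; _⊆_)
open import Data.List using (List; []; _∷_; length)
open import Data.List.Relation.Unary.Unique.Propositional using (Unique)
import Data.List.Membership.Propositional as LMem
open import Data.Product using (Σ; _×_; ∃; ∃₂)
open import Relation.Binary.PropositionalEquality using (_≡_; _≢_)
open import Relation.Nullary using (¬_)
open import Function.Bundles using (_⇔_)
open import Algebra.Structures using (IsGroup)

HasCard : {A : Set} → (A → Set) → ℕ → Set
HasCard {A} P k =
  Σ (List A) λ L → Unique L × (∀ x → (x LMem.∈ L) ⇔ P x) × length L ≡ k

record FinGroup : Set₁ where
  infixl 7 _∙_
  field
    n       : ℕ
    _∙_     : Fin n → Fin n → Fin n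
    ε       : Fin n
    _⁻¹     : Fin n → Fin n
    isGroup : IsGroup _≡_ _∙_ ε _⁻¹

module _ (Γ : FinGroup) where
  open FinGroup Γ

  Nonabelian : Set
  Nonabelian = ∃₂ λ a b → a ∙ b ≢ b ∙ a

  IsCentral : Fin n → Set
  IsCentral z = ∀ a → z ∙ a ≡ a ∙ z

  IsSubgroup : Subset n → Set
  IsSubgroup S = (ε ∈ S)
               × (∀ {x y} → x ∈ S → y ∈ S → (x ∙ y) ∈ S)
               × (∀ {x} → x ∈ S → (x ⁻¹) ∈ S)

  IsAbelianSubgroup : Subset n → Set
  IsAbelianSubgroup S = IsSubgroup S × (∀ {x y} → x ∈ S → y ∈ S → x ∙ y ≡ y ∙ x)

  IsMaximalAbelianSubgroup : Subset n → Set
  IsMaximalAbelianSubgroup S =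
    IsAbelianSubgroup S × (∀ T → IsAbelianSubgroup T → S ⊆ T → T ≡ S)

  CGAdj : Fin n → Fin n → Set
  CGAdj a b = (a ≢ b) × (a ∙ b ≡ b ∙ a)

module _ {n : ℕ} (Adj : Fin n → Fin n → Set) where

  data Walk : Fin n → Fin n → Set where
    []  : ∀ {u} → Walk u u
    _∷_ : ∀ {u w v} → Adj u w → Walk w v → Walk u v

  vertices : ∀ {u v} → Walk u v → List (Fin n)
  vertices {u} []      = u ∷ []
  vertices {u} (_ ∷ p) = u ∷ vertices p

  -- edge colouring with colours Fin k (symmetric, i.e. a colouring of
  -- undirected edges)
  record EdgeColouring (k : ℕ) : Set where
    field
      col  : Fin n → Fin n → Fin k
      symm : ∀ a b → Adj a b → col a b ≡ col b a

  edgeColours : ∀ {k u v} → EdgeColouring k → Walk u v → List (Fin k)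
  edgeColours c []               = []
  edgeColours {u = u} c (_∷_ {w = w} _ p) = EdgeColouring.col c u w ∷ edgeColours c p

  RainbowPath : ∀ {k} → EdgeColouring k → Fin n → Fin n → Set
  RainbowPath c u v =
    Σ (Walk u v) λ p → Unique (vertices p) × Unique (edgeColours c p)

  RainbowConnecting : ∀ {k} → EdgeColouring k → Set
  RainbowConnecting c = ∀ u v → u ≢ v → RainbowPath c u v

  RainbowColourable : ℕ → Set
  RainbowColourable k = Σ (EdgeColouring k) RainbowConnecting

  RcEq : ℕ → Set
  RcEq k = RainbowColourable k × (∀ j → j < k → ¬ RainbowColourable j)

CG : (Γ : FinGroup) → Fin (FinGroup.n Γ) → Fin (FinGroup.n Γ) → Set
CG Γ = CGAdj Γ

-- Every element lies in a maximal abelian subgroup; numbering the c ≤ 2^z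
-- maximal abelian subgroups gives each element a binary word indexed by the
-- z central elements, and two elements that do not commute get different
-- words.  Central elements are adjacent to everything, so colour the edge
-- between a non-central a and the j-th central element by the j-th letter of
-- the word of a: two non-commuting u, v are then joined by the rainbow path
-- u — z_j — v through a position j where their words differ.  Two colours are
-- also necessary, as non-commuting elements are at distance two.
module Submission where

open import Defs
open import Data.Nat using (ℕ; suc; _≤_; _^_; s≤s; >-nonZero⁻¹)
open import Data.Nat.Properties using (<⇒≱)
open import Data.Fin using (Fin; zero; suc; _≟_; remQuot; combine; inject≤)
open import Data.Fin.Properties using (nonZeroIndex; combine-remQuot; inject≤-injective; all?; any?)
open import Data.Fin.Subset using (Subset; _∈_; _⊆_; _⊂_; _⊃_; _∪_; ⁅_⁆)
open import Data.Fin.Subset.Properties using (_∈?_; ⊆-antisym; p⊆p∪q; x∈p∪q⁻; x∈p∪q⁺; x∈⁅x⁆; x∈⁅y⁆⇒x≡y)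
open import Data.Fin.Subset.Induction using (⊃-wellFounded)
open import Data.List using (List; []; _∷_; length; lookup)
open import Data.List.Relation.Unary.Any as Any using (Any)
open import Data.List.Relation.Unary.Any.Properties using (lookup-index)
open import Data.List.Relation.Unary.All using ([]; _∷_)
open import Data.List.Relation.Unary.AllPairs using ([]; _∷_)
open import Data.List.Relation.Unary.Unique.Propositional using (Unique)
open import Data.List.Membership.Propositional using () renaming (_∈_ to _∈ₗ_; _∉_ to _∉ₗ_)
open import Data.List.Membership.Propositional.Properties using (∈-lookup)
open import Data.List.Membership.Propositional.Properties.WithK using (unique⇒irrelevant)
open import Data.Product using (_×_; _,_; proj₁; proj₂; ∃; uncurry)
open import Data.Product.Properties using (×-≡,≡→≡)
open import Data.Sum using (_⊎_; inj₁; inj₂)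
open import Data.Empty using (⊥-elim)
open import Function using (_∘_; id)
open import Function.Bundles using (Equivalence)
open import Induction.WellFounded using (Acc; acc)
open import Relation.Binary.PropositionalEquality using (_≡_; _≢_; refl; sym; trans; cong; subst; module ≡-Reasoning)
open import Relation.Nullary using (¬_; Dec; yes; no)
open import Relation.Nullary.Decidable using (map′; ¬?; _×-dec_; _→-dec_; decidable-stable)
open import Algebra.Structures using (IsGroup)

module _ {m : ℕ} where

  remQuot-injective : ∀ k {i i′ : Fin (m ^ suc k)}
                    → remQuot {m} (m ^ k) i ≡ remQuot {m} (m ^ k) i′ → i ≡ i′
  remQuot-injective k {i} {i′} eq = begin
    i                                        ≡⟨ combine-remQuot {m} (m ^ k) i ⟨
    uncurry combine (remQuot {m} (m ^ k) i)  ≡⟨ cong (uncurry combine) eq ⟩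
    uncurry combine (remQuot {m} (m ^ k) i′) ≡⟨ combine-remQuot {m} (m ^ k) i′ ⟩
    i′                                       ∎
    where open ≡-Reasoning

  digits : ∀ k → Fin (m ^ k) → Fin k → Fin m
  digits 0       _ ()
  digits (suc k) i zero    = proj₁ (remQuot {m} (m ^ k) i)
  digits (suc k) i (suc j) = digits k (proj₂ (remQuot {m} (m ^ k) i)) j

  digits-separate : ∀ k {i i′ : Fin (m ^ k)} → i ≢ i′ → ∃ λ j → digits k i j ≢ digits k i′ j
  digits-separate 0 {zero} {zero} i≢i′ = ⊥-elim (i≢i′ refl)
  digits-separate (suc k) {i} {i′} i≢i′
    with proj₁ (remQuot {m} (m ^ k) i) ≟ proj₁ (remQuot {m} (m ^ k) i′)
  ... | no  q≢q′ = zero , q≢q′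
  ... | yes q≡q′ =
    let j , d = digits-separate k (i≢i′ ∘ remQuot-injective k ∘ ×-≡,≡→≡ ∘ (q≡q′ ,_)) in suc j , d

index-∈-lookup : ∀ {A : Set} (xs : List A) i → Any.index (∈-lookup {xs = xs} i) ≡ i
index-∈-lookup (x ∷ xs) zero    = refl
index-∈-lookup (x ∷ xs) (suc i) = cong suc (index-∈-lookup xs i)

index-lookup-unique : ∀ {A : Set} {xs : List A} → Unique xs
                    → ∀ i (p : lookup xs i ∈ₗ xs) → Any.index p ≡ i
index-lookup-unique {xs = xs} unique i p =
  trans (cong Any.index (unique⇒irrelevant unique p (∈-lookup i))) (index-∈-lookup xs i)

≢⇒2≤ : ∀ {k} {i j : Fin k} → i ≢ j → 2 ≤ k
≢⇒2≤ {i = zero}  {zero}  i≢j = ⊥-elim (i≢j refl)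
≢⇒2≤ {i = zero}  {suc j} _   = s≤s (>-nonZero⁻¹ _ {{nonZeroIndex j}})
≢⇒2≤ {i = suc i}         _   = s≤s (>-nonZero⁻¹ _ {{nonZeroIndex i}})

module _ {n : ℕ} {Adj : Fin n → Fin n → Set} where

  rainbowColourable-nonadjacent⇒2≤ : ∀ {k u v} → u ≢ v → ¬ Adj u v
                                   → RainbowColourable Adj k → 2 ≤ k
  rainbowColourable-nonadjacent⇒2≤ {u = u} {v} u≢v ¬uv (_ , connecting) with connecting u v u≢v
  ... | []              , _ , _                = ⊥-elim (u≢v refl)
  ... | (uv ∷ [])       , _ , _                = ⊥-elim (¬uv uv)
  ... | (_ ∷ _ ∷ _)     , _ , (c₁≢c₂ ∷ _) ∷ _ = ≢⇒2≤ c₁≢c₂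

  rcEq-2 : ∀ {u v} → u ≢ v → ¬ Adj u v → RainbowColourable Adj 2 → RcEq Adj 2
  rcEq-2 u≢v ¬uv twoColours =
    twoColours , λ j j<2 → <⇒≱ j<2 ∘ rainbowColourable-nonadjacent⇒2≤ u≢v ¬uv

module UniversalVertices
  {n : ℕ} {Adj : Fin n → Fin n → Set}
  (Z : List (Fin n)) (unique : Unique Z)
  (universal : ∀ {x} → x ∈ₗ Z → ∀ v → v ≢ x → Adj v x × Adj x v)
  {m : ℕ} (label : Fin n → Fin (length Z) → Fin (suc m))
  (separated : ∀ u v → u ≢ v → Adj u v ⊎ ∃ λ j → label u j ≢ label v j)
  where

  open import Data.List.Membership.DecPropositional {A = Fin n} _≟_ using () renaming (_∈?_ to _∈ₗ?_)

  colour : Fin n → Fin n → Fin (suc m)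
  colour u v with u ∈ₗ? Z | v ∈ₗ? Z
  ... | no _    | yes v∈Z = label u (Any.index v∈Z)
  ... | yes u∈Z | no _    = label v (Any.index u∈Z)
  ... | _       | _       = zero

  colour-sym : ∀ u v → colour u v ≡ colour v u
  colour-sym u v with u ∈ₗ? Z | v ∈ₗ? Z
  ... | no _  | yes _ = refl
  ... | yes _ | no _  = refl
  ... | yes _ | yes _ = refl
  ... | no _  | no _  = refl

  colour-toUniversal : ∀ {u} j → u ∉ₗ Z → colour u (lookup Z j) ≡ label u j
  colour-toUniversal {u} j u∉Z with u ∈ₗ? Z | lookup Z j ∈ₗ? Z
  ... | yes u∈Z | _       = ⊥-elim (u∉Z u∈Z)
  ... | no _    | yes x∈Z = cong (label u) (index-lookup-unique unique j x∈Z)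
  ... | no _    | no x∉Z  = ⊥-elim (x∉Z (∈-lookup j))

  colour-fromUniversal : ∀ {v} j → v ∉ₗ Z → colour (lookup Z j) v ≡ label v j
  colour-fromUniversal {v} j v∉Z = trans (colour-sym (lookup Z j) v) (colour-toUniversal j v∉Z)

  colouring : EdgeColouring Adj (suc m)
  colouring = record { col = colour ; symm = λ u v _ → colour-sym u v }

  edge : ∀ {u v} → u ≢ v → Adj u v → RainbowPath Adj colouring u v
  edge u≢v uv = (uv ∷ []) , ((u≢v ∷ []) ∷ [] ∷ []) , ([] ∷ [])

  detour : ∀ {u v} j → u ∉ₗ Z → v ∉ₗ Z → u ≢ v → label u j ≢ label v j
         → RainbowPath Adj colouring u v
  detour {u} {v} j u∉Z v∉Z u≢v differ =
    (ux ∷ xv ∷ []) , ((u≢x ∷ u≢v ∷ []) ∷ (x≢v ∷ []) ∷ [] ∷ []) , ((ux≢xv ∷ []) ∷ [] ∷ [])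
    where
    x = lookup Z j
    x∈Z = ∈-lookup j
    u≢x : u ≢ x
    u≢x u≡x = u∉Z (subst (_∈ₗ Z) (sym u≡x) x∈Z)
    x≢v : x ≢ v
    x≢v x≡v = v∉Z (subst (_∈ₗ Z) x≡v x∈Z)
    ux = proj₁ (universal x∈Z u u≢x)
    xv = proj₂ (universal x∈Z v (x≢v ∘ sym))
    ux≢xv : colour u x ≢ colour x v
    ux≢xv eq =
      differ (trans (sym (colour-toUniversal j u∉Z)) (trans eq (colour-fromUniversal j v∉Z)))

  connecting : RainbowConnecting Adj colouring
  connecting u v u≢v with u ∈ₗ? Z | v ∈ₗ? Z | separated u v u≢v
  ... | yes u∈Z | _       | _            = edge u≢v (proj₂ (universal u∈Z v (u≢v ∘ sym)))
  ... | no _    | yes v∈Z | _            = edge u≢v (proj₁ (universal v∈Z u u≢v))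
  ... | no _    | no _    | inj₁ uv      = edge u≢v uv
  ... | no u∉Z  | no v∉Z  | inj₂ (j , d) = detour j u∉Z v∉Z u≢v d

  rainbowColourable : RainbowColourable Adj (suc m)
  rainbowColourable = colouring , connecting

module _ (Γ : FinGroup) where
  open FinGroup Γ
  open IsGroup isGroup using (assoc; identityˡ; identityʳ; inverseˡ; inverseʳ)
  open ≡-Reasoning

  Commuting : Subset n → Set
  Commuting S = ∀ {x y} → x ∈ S → y ∈ S → x ∙ y ≡ y ∙ x

  Centralises : Fin n → Subset n → Set
  Centralises w S = ∀ {y} → y ∈ S → w ∙ y ≡ y ∙ w

  centralises? : ∀ w S → Dec (Centralises w S)
  centralises? w S =
    map′ (λ h {y} → h y) (λ h y → h) (all? (λ y → y ∈? S →-dec w ∙ y ≟ y ∙ w))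

  ε-centralises : ∀ {S} → Centralises ε S
  ε-centralises {_} {y} _ = trans (identityˡ y) (sym (identityʳ y))

  ∙-centralises : ∀ {x y S} → Centralises x S → Centralises y S → Centralises (x ∙ y) S
  ∙-centralises {x} {y} xS yS {s} s∈S = begin
    (x ∙ y) ∙ s ≡⟨ assoc x y s ⟩
    x ∙ (y ∙ s) ≡⟨ cong (x ∙_) (yS s∈S) ⟩
    x ∙ (s ∙ y) ≡⟨ assoc x s y ⟨
    (x ∙ s) ∙ y ≡⟨ cong (_∙ y) (xS s∈S) ⟩
    (s ∙ x) ∙ y ≡⟨ assoc s x y ⟩
    s ∙ (x ∙ y) ∎

  ⁻¹-centralises : ∀ {x S} → Centralises x S → Centralises (x ⁻¹) S
  ⁻¹-centralises {x} xS {s} s∈S = begin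
    x ⁻¹ ∙ s                   ≡⟨ cong (x ⁻¹ ∙_) (identityʳ s) ⟨
    x ⁻¹ ∙ (s ∙ ε)             ≡⟨ cong (λ t → x ⁻¹ ∙ (s ∙ t)) (inverseʳ x) ⟨
    x ⁻¹ ∙ (s ∙ (x ∙ x ⁻¹))    ≡⟨ cong (x ⁻¹ ∙_) (assoc s x (x ⁻¹)) ⟨
    x ⁻¹ ∙ ((s ∙ x) ∙ x ⁻¹)    ≡⟨ cong (λ t → x ⁻¹ ∙ (t ∙ x ⁻¹)) (xS s∈S) ⟨
    x ⁻¹ ∙ ((x ∙ s) ∙ x ⁻¹)    ≡⟨ cong (x ⁻¹ ∙_) (assoc x s (x ⁻¹)) ⟩
    x ⁻¹ ∙ (x ∙ (s ∙ x ⁻¹))    ≡⟨ assoc (x ⁻¹) x (s ∙ x ⁻¹) ⟨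
    (x ⁻¹ ∙ x) ∙ (s ∙ x ⁻¹)    ≡⟨ cong (_∙ (s ∙ x ⁻¹)) (inverseˡ x) ⟩
    ε ∙ (s ∙ x ⁻¹)             ≡⟨ identityˡ (s ∙ x ⁻¹) ⟩
    s ∙ x ⁻¹                   ∎

  commuting-⁅⁆ : ∀ a → Commuting ⁅ a ⁆
  commuting-⁅⁆ a x∈ y∈ rewrite x∈⁅y⁆⇒x≡y a x∈ | x∈⁅y⁆⇒x≡y a y∈ = refl

  commuting-∪-⁅⁆ : ∀ {S w} → Commuting S → Centralises w S → Commuting (S ∪ ⁅ w ⁆)
  commuting-∪-⁅⁆ {S} {w} S-comm wS {x} {y} x∈ y∈ with x∈p∪q⁻ S ⁅ w ⁆ x∈ | x∈p∪q⁻ S ⁅ w ⁆ y∈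
  ... | inj₁ x∈S | inj₁ y∈S = S-comm x∈S y∈S
  ... | inj₁ x∈S | inj₂ y≡w rewrite x∈⁅y⁆⇒x≡y w y≡w = sym (wS x∈S)
  ... | inj₂ x≡w | inj₁ y∈S rewrite x∈⁅y⁆⇒x≡y w x≡w = wS y∈S
  ... | inj₂ x≡w | inj₂ y≡w rewrite x∈⁅y⁆⇒x≡y w x≡w | x∈⁅y⁆⇒x≡y w y≡w = refl

  selfCentralising⇒maximalAbelian : ∀ {S} → Commuting S → (∀ {w} → Centralises w S → w ∈ S)
                                  → IsMaximalAbelianSubgroup Γ S
  selfCentralising⇒maximalAbelian S-comm closed =
    ( ( closed ε-centralises
      , (λ x∈S y∈S → closed (∙-centralises (S-comm x∈S) (S-comm y∈S)))
      , (λ x∈S → closed (⁻¹-centralises (S-comm x∈S))))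
    , S-comm)
    , λ T (_ , T-comm) S⊆T → ⊆-antisym (λ x∈T → closed (λ y∈S → T-comm x∈T (S⊆T y∈S))) S⊆T

  commuting⇒⊆-maximalAbelian : ∀ {S} → Commuting S → ∃ λ T → S ⊆ T × IsMaximalAbelianSubgroup Γ T
  commuting⇒⊆-maximalAbelian {S} = go S (⊃-wellFounded S)
    where
    go : ∀ S → Acc _⊃_ S → Commuting S → ∃ λ T → S ⊆ T × IsMaximalAbelianSubgroup Γ T
    go S (acc larger) S-comm with any? (λ w → centralises? w S ×-dec ¬? (w ∈? S))
    ... | yes (w , wS , w∉S) =
      let T , S∪w⊆T , T-max = go (S ∪ ⁅ w ⁆) (larger S⊂S∪w) (commuting-∪-⁅⁆ S-comm wS)
      in  T , S∪w⊆T ∘ p⊆p∪q ⁅ w ⁆ , T-max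
      where
      S⊂S∪w : S ⊂ S ∪ ⁅ w ⁆
      S⊂S∪w = p⊆p∪q ⁅ w ⁆ , w , x∈p∪q⁺ (inj₂ (x∈⁅x⁆ w)) , w∉S
    ... | no noOutsider =
      S , id , selfCentralising⇒maximalAbelian S-comm
                 (λ {w} wS → decidable-stable (w ∈? S) (λ w∉S → noOutsider (w , wS , w∉S)))

  ∈-maximalAbelian : ∀ a → ∃ λ S → IsMaximalAbelianSubgroup Γ S × a ∈ S
  ∈-maximalAbelian a =
    let S , a⊆S , S-max = commuting⇒⊆-maximalAbelian (commuting-⁅⁆ a)
    in  S , S-max , a⊆S (x∈⁅x⁆ a)

  maximalAbelianCover : (L : List (Subset n)) → (∀ {S} → IsMaximalAbelianSubgroup Γ S → S ∈ₗ L)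
                      → ∀ a → Any (a ∈_) L
  maximalAbelianCover L complete a =
    let S , S-max , a∈S = ∈-maximalAbelian a
    in  Any.map (λ S≡T → subst (a ∈_) S≡T a∈S) (complete S-max)

  sameIndex⇒commute : ∀ {L : List (Subset n)} → (∀ {S} → S ∈ₗ L → Commuting S)
                    → ∀ {u v} (p : Any (u ∈_) L) (q : Any (v ∈_) L) → Any.index p ≡ Any.index q
                    → u ∙ v ≡ v ∙ u
  sameIndex⇒commute {L} L-comm {v = v} p q p≡q =
    L-comm (∈-lookup (Any.index p))
           (lookup-index p)
           (subst (λ i → v ∈ lookup L i) (sym p≡q) (lookup-index q))

  central⇒universal : ∀ {x} → IsCentral Γ x → ∀ v → v ≢ x → CGAdj Γ v x × CGAdj Γ x v
  central⇒universal x-central v v≢x = (v≢x , sym (x-central v)) , (v≢x ∘ sym , x-central v)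

theorem4 : (Γ : FinGroup) → Nonabelian Γ
    → (z c : ℕ)
    → HasCard (IsCentral Γ) z → 2 ≤ z
    → HasCard (IsMaximalAbelianSubgroup Γ) c → c ≤ 2 ^ z
    → RcEq (CG Γ) 2
theorem4 Γ (a , b , ab≢ba) _ _ (Z , Z-unique , Z-centre , refl) _ (L , _ , L-maxAb , refl) c≤2^z =
  rcEq-2 a≢b (ab≢ba ∘ proj₂) (UniversalVertices.rainbowColourable Z Z-unique Z-universal label separated)
  where
  open FinGroup Γ using (n; _∙_)

  a≢b : a ≢ b
  a≢b a≡b = ab≢ba (subst (λ t → a ∙ t ≡ t ∙ a) a≡b refl)

  Z-universal : ∀ {x} → x ∈ₗ Z → ∀ v → v ≢ x → CGAdj Γ v x × CGAdj Γ x v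
  Z-universal = central⇒universal Γ ∘ Equivalence.to (Z-centre _)

  L-abelian : ∀ {S} → S ∈ₗ L → Commuting Γ S
  L-abelian = proj₂ ∘ proj₁ ∘ Equivalence.to (L-maxAb _)

  cover : ∀ u → Any (u ∈_) L
  cover = maximalAbelianCover Γ L (Equivalence.from (L-maxAb _))

  label : Fin n → Fin (length Z) → Fin 2
  label u = digits (length Z) (inject≤ (Any.index (cover u)) c≤2^z)

  separated : ∀ u v → u ≢ v → CGAdj Γ u v ⊎ ∃ λ j → label u j ≢ label v j
  separated u v u≢v with u ∙ v ≟ v ∙ u
  ... | yes uv≡vu = inj₁ (u≢v , uv≡vu)
  ... | no  uv≢vu = inj₂ (digits-separate (length Z)
          (uv≢vu ∘ sameIndex⇒commute Γ L-abelian (cover u) (cover v) ∘ inject≤-injective _ _ _ _))
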